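{- Let $AP$ be a set of atomic propositions. For every $u\in(2^{AP})^\omega$ and every $\mathrm{LTL}^{>}$ formula $\phi$, $$[\![\neg\phi]\!](u)=\begin{cases}\overline{[\![\phi]\!]}(u)+1 & \text{if } \overline{[\![\phi]\!]}(u)>0,\\ 0 & \text{if for all } n\in\mathbb{N},\ (u,n)\not\models_{\sup}\phi,\\ 1 & \text{otherwise,}\end{cases}$$ with the convention $\infty+1=\infty$.
   Context: Notation: for $u \in (2^{AP})^{\omega}$, $u_i$ is its $i$-th letter and $u^i$ its suffix starting at $u_i$. $\mathrm{LTL}^{\leq}$: grammar $\phi ::= a \mid \neg a \mid \phi\vee\phi \mid \phi\wedge\phi \mid \phi\mathbf{U}\phi \mid \phi\mathbf{R}\phi \mid \mathbf{X}\phi \mid \phi\mathbf{U}^{\leq}\phi$ ($a\in AP$), with relation $(u,n)\models_{\inf}$: $(u,n)\models a$ iff $a\in u_0$; $(u,n)\models\neg a$ iff $a\notin u_0$; $\vee,\wedge$ as usual; $(u,n)\models\mathbf{X}\phi_1$ iff $(u^1,n)\models\phi_1$; $\phi_1\mathbf{U}\phi_2$: some $i$ with $(u^i,n)\models\phi_2$ and $(u^j,n)\models\phi_1$ for all $j<i$; $\phi_1\mathbf{R}\phi_2$: for all $i$, $(u^i,n)\models\phi_2$ or some $j<i$ has $(u^j,n)\models\phi_1$; $\phi_1\mathbf{U}^{\leq}\phi_2$: some $i$ with $(u^i,n)\models\phi_2$ and $|\{j<i\mid (u^j,n)\not\models\phi_1\}|\leq n$. Value $[\![\phi]\!](u)=\inf\{n\mid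 (u,n)\models_{\inf}\phi\}$, $\inf\emptyset=\infty$. $\mathrm{LTL}^{>}$: grammar $\phi ::= a \mid \neg a \mid \phi\vee\phi \mid \phi\wedge\phi \mid \phi\mathbf{U}\phi \mid \phi\mathbf{R}\phi \mid \mathbf{X}\phi \mid \phi\mathbf{R}^{>}\phi$, with relation $(u,n)\models_{\sup}$ defined by the same clauses for the common operators, and $(u,n)\models_{\sup}\phi_1\mathbf{R}^{>}\phi_2$ iff for every $i\in\mathbb{N}$, either $(u^i,n)\models_{\sup}\phi_2$ or $|\{j<i\mid (u^j,n)\models_{\sup}\phi_1\}|>n$. Value $\overline{[\![\phi]\!]}(u)=\sup\{n\mid (u,n)\models_{\sup}\phi\}$, with $\sup\emptyset=0$. Negation: for $\phi$ in $\mathrm{LTL}^{>}$, $\neg\phi$ is the $\mathrm{LTL}^{\leq}$ formula obtained by pushing negation to the leaves: $\neg(a)=\neg a$, $\neg(\neg a)=a$, $\vee\leftrightarrow\wedge$, $\mathbf{U}\leftrightarrow\mathbf{R}$, $\mathbf{R}^{>}\mapsto\mathbf{U}^{\leq}$ (i.e. $\neg(\phi_1\mathbf{R}^{>}\phi_2)=\neg\phi_1\mathbf{U}^{\leq}\neg\phi_2$), and $\neg\mathbf{X}\phi_1=\mathbf{X}\neg\phi_1$. -}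

module Defs where

open import Level using (0ℓ)
open import Data.Nat using (ℕ; zero; suc; _+_; _≤_; _<_)
open import Data.Product using (Σ; _×_; _,_)
open import Data.Sum using (_⊎_)
open import Relation.Nullary using (¬_)

data ℕ∞ : Set where
  fin : ℕ → ℕ∞
  ∞   : ℕ∞

data _≤∞_ : ℕ∞ → ℕ∞ → Set where
  fin≤fin : ∀ {m n} → m ≤ n → fin m ≤∞ fin n
  _≤∞top  : ∀ x → x ≤∞ ∞

data _<∞_ : ℕ∞ → ℕ∞ → Set where
  fin<fin : ∀ {m n} → m < n → fin m <∞ fin n
  fin<∞   : ∀ {m} → fin m <∞ ∞

_+1∞ : ℕ∞ → ℕ∞
fin n +1∞ = fin (suc n)
∞ +1∞ = ∞

-- inf / sup of a subset S of ℕ, taken in ℕ∞ (greatest lower / least upper bound).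
-- inf ∅ = ∞ and sup ∅ = 0 follow automatically.
IsInf : (ℕ → Set) → ℕ∞ → Set
IsInf S v = (∀ n → S n → v ≤∞ fin n)
          × (∀ w → (∀ n → S n → w ≤∞ fin n) → w ≤∞ v)

IsSup : (ℕ → Set) → ℕ∞ → Set
IsSup S v = (∀ n → S n → fin n ≤∞ v)
          × (∀ w → (∀ n → S n → fin n ≤∞ w) → v ≤∞ w)

data CountIs (P : ℕ → Set) : ℕ → ℕ → Set where
  c-zero : CountIs P 0 0
  c-yes  : ∀ {i k} → P i → CountIs P i k → CountIs P (suc i) (suc k)
  c-no   : ∀ {i k} → ¬ P i → CountIs P i k → CountIs P (suc i) k

CountLe : (ℕ → Set) → ℕ → ℕ → Set
CountLe P i n = Σ ℕ λ k → CountIs P i k × k ≤ n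

CountGt : (ℕ → Set) → ℕ → ℕ → Set
CountGt P i n = Σ ℕ λ k → CountIs P i k × n < k

-- Letters are subsets of AP, words are infinite sequences of letters
Letter : Set → Set₁
Letter AP = AP → Set

Word : Set → Set₁
Word AP = ℕ → Letter AP

suffix : ∀ {AP} → Word AP → ℕ → Word AP
suffix u i = λ k → u (i + k)

data LTL≤ (AP : Set) : Set where
  atom  : AP → LTL≤ AP
  natom : AP → LTL≤ AP
  _∨_ _∧_ _U_ _R_ _U≤_ : LTL≤ AP → LTL≤ AP → LTL≤ AP
  X     : LTL≤ AP → LTL≤ AP

data LTL> (AP : Set) : Set where
  atom  : AP → LTL> AP
  natom : AP → LTL> AP
  _∨_ _∧_ _U_ _R_ _R>_ : LTL> AP → LTL> AP → LTL> AP
  X     : LTL> AP → LTL> AP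

SatInf : ∀ {AP} → Word AP → ℕ → LTL≤ AP → Set
SatInf u n (atom a)  = u 0 a
SatInf u n (natom a) = ¬ u 0 a
SatInf u n (φ ∨ ψ)   = SatInf u n φ ⊎ SatInf u n ψ
SatInf u n (φ ∧ ψ)   = SatInf u n φ × SatInf u n ψ
SatInf u n (φ U ψ)   = Σ ℕ λ i → SatInf (suffix u i) n ψ
                         × (∀ j → j < i → SatInf (suffix u j) n φ)
SatInf u n (φ R ψ)   = ∀ i → SatInf (suffix u i) n ψ
                         ⊎ Σ ℕ (λ j → j < i × SatInf (suffix u j) n φ)
SatInf u n (X φ)     = SatInf (suffix u 1) n φ
SatInf u n (φ U≤ ψ)  = Σ ℕ λ i → SatInf (suffix u i) n ψ
                         × CountLe (λ j → ¬ SatInf (suffix u j) n φ) i n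

SatSup : ∀ {AP} → Word AP → ℕ → LTL> AP → Set
SatSup u n (atom a)  = u 0 a
SatSup u n (natom a) = ¬ u 0 a
SatSup u n (φ ∨ ψ)   = SatSup u n φ ⊎ SatSup u n ψ
SatSup u n (φ ∧ ψ)   = SatSup u n φ × SatSup u n ψ
SatSup u n (φ U ψ)   = Σ ℕ λ i → SatSup (suffix u i) n ψ
                         × (∀ j → j < i → SatSup (suffix u j) n φ)
SatSup u n (φ R ψ)   = ∀ i → SatSup (suffix u i) n ψ
                         ⊎ Σ ℕ (λ j → j < i × SatSup (suffix u j) n φ)
SatSup u n (X φ)     = SatSup (suffix u 1) n φ
SatSup u n (φ R> ψ)  = ∀ i → SatSup (suffix u i) n ψ
                         ⊎ CountGt (λ j → SatSup (suffix u j) n φ) i n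

neg : ∀ {AP} → LTL> AP → LTL≤ AP
neg (atom a)  = natom a
neg (natom a) = atom a
neg (φ ∨ ψ)   = neg φ ∧ neg ψ
neg (φ ∧ ψ)   = neg φ ∨ neg ψ
neg (φ U ψ)   = neg φ R neg ψ
neg (φ R ψ)   = neg φ U neg ψ
neg (X φ)     = X (neg φ)
neg (φ R> ψ)  = neg φ U≤ neg ψ

-- value [[φ]](u) (relationally: v is the inf of {n | (u,n) ⊨_inf φ})
InfValue : ∀ {AP} → LTL≤ AP → Word AP → ℕ∞ → Set
InfValue φ u v = IsInf (λ n → SatInf u n φ) v

-- value overline[[φ]](u) (sup of {n | (u,n) ⊨_sup φ})
SupValue : ∀ {AP} → LTL> AP → Word AP → ℕ∞ → Set
SupValue φ u v = IsSup (λ n → SatSup u n φ) v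

-- The sup-semantics of an LTL> formula is downward closed in the bound n, and
-- classically (u , n) ⊨_inf ¬φ holds exactly when (u , n) ⊨_sup φ fails.  Hence the
-- bounds satisfying ¬φ form the complement of an initial segment S of ℕ: if S is
-- all of ℕ both values are ∞, if S = {0, …, t} the sup is t and the inf of the
-- complement is t + 1, and if S is empty the inf is 0.
module Submission where

open import Defs
open import Level using (0ℓ)
open import Function using (_∘_)
open import Data.Nat using (ℕ; zero; suc; _≤_; _<_; z≤n; s≤s; s≤s⁻¹; _≤?_)
open import Data.Nat.Properties
  using (≤-antisym; ≤-trans; ≤-refl; <-≤-trans; ≤-<-trans; ≮⇒≥; ≰⇒>; n≮n; m≤n⇒m≤1+n; n≤1+n)
open import Data.Product using (_×_; Σ; ∃; _,_; proj₁; proj₂)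
open import Data.Sum using (inj₁; inj₂)
open import Data.Empty using (⊥-elim)
open import Relation.Nullary using (¬_; yes; no)
open import Relation.Unary using (Decidable)
open import Relation.Binary.PropositionalEquality using (_≡_; refl; cong)
open import Axiom.ExcludedMiddle using (ExcludedMiddle)
open import Axiom.DoubleNegationElimination using (DoubleNegationElimination; em⇒dne)

¬∀⇒∃¬ : DoubleNegationElimination 0ℓ → {P : ℕ → Set} → ¬ (∀ n → P n) → ∃ λ n → ¬ P n
¬∀⇒∃¬ dne h = dne λ none → h λ n → dne λ ¬pn → none (n , ¬pn)

¬→⇒×¬ : DoubleNegationElimination 0ℓ → {A B : Set} → ¬ (A → B) → A × ¬ B
¬→⇒×¬ dne h = dne (λ ¬a → h (⊥-elim ∘ ¬a)) , λ b → h λ _ → b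

≤∞-trans : ∀ {x y z} → x ≤∞ y → y ≤∞ z → x ≤∞ z
≤∞-trans (fin≤fin p) (fin≤fin q) = fin≤fin (≤-trans p q)
≤∞-trans _ (y ≤∞top) = _ ≤∞top

≤∞-antisym : ∀ {x y} → x ≤∞ y → y ≤∞ x → x ≡ y
≤∞-antisym (fin≤fin p) (fin≤fin q) = cong fin (≤-antisym p q)
≤∞-antisym (x ≤∞top) (.∞ ≤∞top) = refl

fin-suc≰∞fin : ∀ {n} → ¬ (fin (suc n) ≤∞ fin n)
fin-suc≰∞fin {n} (fin≤fin p) = n≮n n p

IsInf-unique : ∀ {P v w} → IsInf P v → IsInf P w → v ≡ w
IsInf-unique (lower-v , greatest-v) (lower-w , greatest-w) =
  ≤∞-antisym (greatest-w _ lower-v) (greatest-v _ lower-w)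

IsInf-least : ∀ {P m} → P m → (∀ n → P n → m ≤ n) → IsInf P (fin m)
IsInf-least pm least = (λ n pn → fin≤fin (least n pn)) , (λ w lower → lower _ pm)

IsInf-empty : ∀ {P} → (∀ n → ¬ P n) → IsInf P ∞
IsInf-empty none = (λ n pn → ⊥-elim (none n pn)) , (λ w _ → w ≤∞top)

IsInf-cong : ∀ {P Q v} → (∀ {n} → P n → Q n) → (∀ {n} → Q n → P n) → IsInf P v → IsInf Q v
IsInf-cong P⇒Q Q⇒P (lower , greatest) =
  (λ n qn → lower n (Q⇒P qn)) , (λ w lower-Q → greatest w λ n pn → lower-Q n (P⇒Q pn))

CountIs-mono : ∀ {P Q} → (∀ {j} → P j → Q j) →
               ∀ {i k l} → CountIs P i k → CountIs Q i l → k ≤ l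
CountIs-mono P⇒Q c-zero        c-zero        = z≤n
CountIs-mono P⇒Q (c-yes p c)   (c-yes q d)   = s≤s (CountIs-mono P⇒Q c d)
CountIs-mono P⇒Q (c-yes p c)   (c-no ¬q d)   = ⊥-elim (¬q (P⇒Q p))
CountIs-mono P⇒Q (c-no ¬p c)   (c-yes q d)   = m≤n⇒m≤1+n (CountIs-mono P⇒Q c d)
CountIs-mono P⇒Q (c-no ¬p c)   (c-no ¬q d)   = CountIs-mono P⇒Q c d

count : ∀ {P} → Decidable P → ∀ i → Σ ℕ (CountIs P i)
count P? zero = 0 , c-zero
count P? (suc i) with count P? i | P? i
... | k , c | yes p = suc k , c-yes p c
... | k , c | no ¬p = k , c-no ¬p c

Downward : (ℕ → Set) → Set
Downward S = ∀ {m n} → m ≤ n → S n → S m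

module DownwardClosed {S : ℕ → Set} (downward : Downward S) where

  member<nonmember : ∀ {m c} → S m → ¬ S c → m < c
  member<nonmember {m} {c} sm ¬sc with c ≤? m
  ... | yes c≤m = ⊥-elim (¬sc (downward c≤m sm))
  ... | no  c≰m = ≰⇒> c≰m

  sup≤nonmember-pred : ∀ {s c} → IsSup S s → ¬ S (suc c) → s ≤∞ fin c
  sup≤nonmember-pred (_ , least) ¬sc = least _ λ m sm → fin≤fin (s≤s⁻¹ (member<nonmember sm ¬sc))

  inf-complement-boundary : ∀ {t} → S t → ¬ S (suc t) → IsInf (¬_ ∘ S) (fin (suc t))
  inf-complement-boundary st ¬st+1 = IsInf-least ¬st+1 λ n ¬sn → member<nonmember st ¬sn

  inf-complement-full : (∀ n → S n) → IsInf (¬_ ∘ S) ∞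
  inf-complement-full all = IsInf-empty λ n ¬sn → ¬sn (all n)

  inf-complement-empty : ∀ {i} → (∀ n → ¬ S n) → IsInf (¬_ ∘ S) i → i ≡ fin 0
  inf-complement-empty none inf = IsInf-unique inf (IsInf-least (none 0) λ _ _ → z≤n)

  module _ (dne : DoubleNegationElimination 0ℓ) where

    member-below-sup : ∀ {s c} → IsSup S s → fin (suc c) ≤∞ s → S (suc c)
    member-below-sup sup c+1≤s =
      dne λ ¬sc → fin-suc≰∞fin (≤∞-trans c+1≤s (sup≤nonmember-pred sup ¬sc))

    inf-complement-positive : ∀ {s i} → IsSup S s → IsInf (¬_ ∘ S) i → fin 0 <∞ s → i ≡ s +1∞
    inf-complement-positive sup inf fin<∞ =
      IsInf-unique inf (inf-complement-full λ n →
        downward (n≤1+n n) (member-below-sup sup (fin (suc n) ≤∞top)))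
    inf-complement-positive sup inf (fin<fin {n = suc t} _) =
      IsInf-unique inf (inf-complement-boundary
        (member-below-sup sup (fin≤fin ≤-refl))
        (fin-suc≰∞fin ∘ proj₁ sup _))

    inf-complement-singleton : ∀ {s i} → IsSup S s → IsInf (¬_ ∘ S) i →
                               ¬ (fin 0 <∞ s) → ¬ (∀ n → ¬ S n) → i ≡ fin 1
    inf-complement-singleton sup inf s≯0 nonempty =
      IsInf-unique inf (inf-complement-boundary s0 (s≯0 ∘ positive ∘ proj₁ sup 1))
      where
        s0 : S 0
        s0 = dne λ ¬s0 → nonempty λ n sn → ¬s0 (downward z≤n sn)

        positive : ∀ {x} → fin 1 ≤∞ x → fin 0 <∞ x
        positive (fin≤fin (s≤s _)) = fin<fin (s≤s z≤n)
        positive (_ ≤∞top)         = fin<∞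

SatSup-downward : ExcludedMiddle 0ℓ → ∀ {AP} (φ : LTL> AP) {u : Word AP} →
                  Downward (λ n → SatSup u n φ)
SatSup-downward em (atom a)  le s = s
SatSup-downward em (natom a) le s = s
SatSup-downward em (φ ∨ ψ) le (inj₁ s) = inj₁ (SatSup-downward em φ le s)
SatSup-downward em (φ ∨ ψ) le (inj₂ s) = inj₂ (SatSup-downward em ψ le s)
SatSup-downward em (φ ∧ ψ) le (s , t)  = SatSup-downward em φ le s , SatSup-downward em ψ le t
SatSup-downward em (φ U ψ) le (i , sψ , sφ) =
  i , SatSup-downward em ψ le sψ , λ j j<i → SatSup-downward em φ le (sφ j j<i)
SatSup-downward em (φ R ψ) le h i with h i
... | inj₁ sψ            = inj₁ (SatSup-downward em ψ le sψ)
... | inj₂ (j , j<i , sφ) = inj₂ (j , j<i , SatSup-downward em φ le sφ)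
SatSup-downward em (X φ) le s = SatSup-downward em φ le s
SatSup-downward em (φ R> ψ) le h i with h i
... | inj₁ sψ = inj₁ (SatSup-downward em ψ le sψ)
... | inj₂ (k , c , n<k) with count (λ _ → em) i
...   | l , d = inj₂ (l , d , <-≤-trans (≤-<-trans le n<k) (CountIs-mono (SatSup-downward em φ le) c d))

SatInf-neg⇒¬SatSup : ∀ {AP} (φ : LTL> AP) {u n} → SatInf u n (neg φ) → ¬ SatSup u n φ
SatInf-neg⇒¬SatSup (atom a)  ¬ua ua = ¬ua ua
SatInf-neg⇒¬SatSup (natom a) ua ¬ua = ¬ua ua
SatInf-neg⇒¬SatSup (φ ∨ ψ) (nφ , nψ) (inj₁ sφ) = SatInf-neg⇒¬SatSup φ nφ sφ
SatInf-neg⇒¬SatSup (φ ∨ ψ) (nφ , nψ) (inj₂ sψ) = SatInf-neg⇒¬SatSup ψ nψ sψ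
SatInf-neg⇒¬SatSup (φ ∧ ψ) (inj₁ nφ) (sφ , sψ) = SatInf-neg⇒¬SatSup φ nφ sφ
SatInf-neg⇒¬SatSup (φ ∧ ψ) (inj₂ nψ) (sφ , sψ) = SatInf-neg⇒¬SatSup ψ nψ sψ
SatInf-neg⇒¬SatSup (φ U ψ) h (i , sψ , sφ) with h i
... | inj₁ nψ            = SatInf-neg⇒¬SatSup ψ nψ sψ
... | inj₂ (j , j<i , nφ) = SatInf-neg⇒¬SatSup φ nφ (sφ j j<i)
SatInf-neg⇒¬SatSup (φ R ψ) (i , nψ , nφ) h with h i
... | inj₁ sψ            = SatInf-neg⇒¬SatSup ψ nψ sψ
... | inj₂ (j , j<i , sφ) = SatInf-neg⇒¬SatSup φ (nφ j j<i) sφ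
SatInf-neg⇒¬SatSup (X φ) n s = SatInf-neg⇒¬SatSup φ n s
SatInf-neg⇒¬SatSup (φ R> ψ) {n = n} (i , nψ , k , c , k≤n) h with h i
... | inj₁ sψ = SatInf-neg⇒¬SatSup ψ nψ sψ
... | inj₂ (l , d , n<l) =
  n≮n n (<-≤-trans n<l (≤-trans (CountIs-mono (λ sφ nφ → SatInf-neg⇒¬SatSup φ nφ sφ) d c) k≤n))

¬SatSup⇒SatInf-neg : ExcludedMiddle 0ℓ → ∀ {AP} (φ : LTL> AP) {u n} → ¬ SatSup u n φ → SatInf u n (neg φ)
¬SatSup⇒SatInf-neg em (atom a)  ¬s = ¬s
¬SatSup⇒SatInf-neg em (natom a) ¬s = em⇒dne em ¬s
¬SatSup⇒SatInf-neg em (φ ∨ ψ) ¬s =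
  ¬SatSup⇒SatInf-neg em φ (¬s ∘ inj₁) , ¬SatSup⇒SatInf-neg em ψ (¬s ∘ inj₂)
¬SatSup⇒SatInf-neg em (φ ∧ ψ) {u} {n} ¬s with em {SatSup u n φ}
... | yes sφ = inj₂ (¬SatSup⇒SatInf-neg em ψ λ sψ → ¬s (sφ , sψ))
... | no ¬sφ = inj₁ (¬SatSup⇒SatInf-neg em φ ¬sφ)
¬SatSup⇒SatInf-neg em (φ U ψ) {u} {n} ¬s i with em {SatSup (suffix u i) n ψ}
... | no ¬sψ = inj₁ (¬SatSup⇒SatInf-neg em ψ ¬sψ)
... | yes sψ with ¬∀⇒∃¬ (em⇒dne em) (λ sφ → ¬s (i , sψ , sφ))
...   | j , ¬[j<i→sφ] with ¬→⇒×¬ (em⇒dne em) ¬[j<i→sφ]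
...     | j<i , ¬sφ = inj₂ (j , j<i , ¬SatSup⇒SatInf-neg em φ ¬sφ)
¬SatSup⇒SatInf-neg em (φ R ψ) ¬s with ¬∀⇒∃¬ (em⇒dne em) ¬s
... | i , ¬si = i , ¬SatSup⇒SatInf-neg em ψ (¬si ∘ inj₁) ,
                λ j j<i → ¬SatSup⇒SatInf-neg em φ λ sφ → ¬si (inj₂ (j , j<i , sφ))
¬SatSup⇒SatInf-neg em (X φ) ¬s = ¬SatSup⇒SatInf-neg em φ ¬s
¬SatSup⇒SatInf-neg em (φ R> ψ) {u} {n} ¬s with ¬∀⇒∃¬ (em⇒dne em) ¬s
... | i , ¬si = i , ¬SatSup⇒SatInf-neg em ψ (¬si ∘ inj₁) , k , c , k≤n
  where
    ¬Nφ Sφ : ℕ → Set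
    ¬Nφ j = ¬ SatInf (suffix u j) n (neg φ)
    Sφ  j = SatSup (suffix u j) n φ

    ¬Nφ⇒Sφ : ∀ {j} → ¬Nφ j → Sφ j
    ¬Nφ⇒Sφ ¬nφ = em⇒dne em λ ¬sφ → ¬nφ (¬SatSup⇒SatInf-neg em φ ¬sφ)

    ¬Nφ-count : Σ ℕ (CountIs ¬Nφ i)
    ¬Nφ-count = count (λ _ → em) i

    k : ℕ
    k = proj₁ ¬Nφ-count

    c : CountIs ¬Nφ i k
    c = proj₂ ¬Nφ-count

    k≤n : k ≤ n
    k≤n with count {Sφ} (λ _ → em) i
    ... | l , d = ≤-trans (CountIs-mono ¬Nφ⇒Sφ c d) (≮⇒≥ λ n<l → ¬si (inj₂ (l , d , n<l)))

proposition3 : ExcludedMiddle 0ℓ →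
    (AP : Set) (u : Word AP) (φ : LTL> AP) (s i : ℕ∞) →
    SupValue φ u s → InfValue (neg φ) u i →
    ((fin 0 <∞ s → i ≡ s +1∞)
    × ((∀ n → ¬ SatSup u n φ) → i ≡ fin 0)
    × (¬ (fin 0 <∞ s) → ¬ (∀ n → ¬ SatSup u n φ) → i ≡ fin 1))
proposition3 em AP u φ s i sup inf =
    inf-complement-positive (em⇒dne em) sup inf-complement
  , (λ none → inf-complement-empty none inf-complement)
  , inf-complement-singleton (em⇒dne em) sup inf-complement
  where
    open DownwardClosed (SatSup-downward em φ)

    inf-complement : IsInf (λ n → ¬ SatSup u n φ) i
    inf-complement = IsInf-cong (SatInf-neg⇒¬SatSup φ) (¬SatSup⇒SatInf-neg em φ) inf
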